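{- Let $G$ be a game and let $g$ be a strategy on $G$. Then there exists a skeleton $\sigma$ on $G$ which is valid (i.e. $\sigma\lesssim_G\sigma$) and implements $g$.
   Context: A move is a triple $(m,x,y)$ with $x\in\{O,P\}$ (O-move/P-move) and $y\in\{Q,A\}$ (question/answer). A justified (j-)sequence is a finite sequence $s=s(1)\cdots s(|s|)$ of moves with a map $\mathcal J_s:\{1,\dots,|s|\}\to\{0,\dots,|s|-1\}$, $\mathcal J_s(i)<i$; if $\mathcal J_s(i)=0$ the occurrence $s(i)$ is initial, otherwise it is justified by $s(\mathcal J_s(i))$. J-sequences are equal iff they have the same moves and pointers; prefixes inherit pointers; $sm$ denotes extension by one move (with a pointer). For a set $X$ of j-sequences, $X^{\mathrm{Even}}$ ($X^{\mathrm{Odd}}$) is the set of its even-(odd-)length elements. The P-view $\lceil s\rceil$ and O-view $\lfloor s\rfloor$ are the j-subsequences (pointers obtained by following pointer chains through deleted occurrences) given by: $\lceil\epsilon\rceil=\epsilon$; $\lceil sm\rceil=\lceil s\rceil m$ if $m$ is a P-move; $\lceil sm\rceil=m$ if $m$ is initial; $\lceil smtn\rceil=\lceil s\rceil mn$ if $n$ is an O-move justified by $m$; $\lfloor\epsilon\rfloor=\epsilon$; $\lfloor sm\rfloor=\lfloor s\rfloor m$ if $m$ is an O-move; $\lfloor smtn\rfloor=\lfloor s\rfloor mn$ if $n$ is a P-move justified by $m$. A legal position is a j-sequence in which consecutive moves have distinct O/P labels and such that whenever $s=tmu$ with $m$ non-initial, the justifier of $m$ occurs in $\lceil t\rceil$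 if $m$ is a P-move and in $\lfloor t\rfloor$ otherwise. A game is a pair $G=(P_G,\simeq_G)$ where $P_G$ is a non-empty prefix-closed set of legal positions and $\simeq_G$ is an equivalence relation on $P_G$ satisfying (I1) $s\simeq_G t\Rightarrow|s|=|t|$; (I2) $sm\simeq_G tn\Rightarrow s\simeq_G t$, $m,n$ carry the same labels and $\mathcal J_{sm}(|sm|)=\mathcal J_{tn}(|tn|)$; (I3) $s\simeq_G t\wedge sm\in P_G\Rightarrow\exists tn\in P_G.\ sm\simeq_G tn$; moreover the induced arena ($M_G$ = moves occurring in $P_G$; $\star\vdash_G m$ iff $m$ occurs initially in some element of $P_G$; $m\vdash_G n$ iff $n$ occurs justified by $m$ in some element of $P_G$) satisfies: $\star\vdash_G m$ implies $m$ is an O-question; $m\vdash_G n$ with $n$ an answer implies $m$ a question; $m\vdash_G n$, $m\neq\star$, implies $m,n$ have distinct O/P labels; and there is no infinite sequence $m_0,m_1,\dots$ with $\star\vdash_G m_0$ and $m_i\vdash_G m_{i+1}$ for all $i$. A skeleton on $G$ is a set $\sigma\subseteq P_G^{\mathrm{Even}}$ that is non-empty, even-prefix-closed ($smn\in\sigma\Rightarrow s\in\sigma$) and deterministic ($smn,smn'\in\sigma\Rightarrow smn=smn'$). For skeletons $\sigma,\tau$ on $G$, $\sigma\lesssim_G\tau$ iff for all $smn\in\sigma$, $t\in\tau$, $tl\in P_G$ with $sm\simeq_G tl$ there is $tlr\in\tau$ with $smn\simeq_G tlr$. A strategy on $G$ is a set $g\subseteq P_G^{\mathrm{Even}}$ that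 is non-empty, even-prefix-closed, satisfies $smn,tlr\in g\wedge sm\simeq_G tl\Rightarrow smn\simeq_G tlr$, and satisfies $s\in g\wedge t\in P_G\wedge s\simeq_G t\Rightarrow t\in g$. A skeleton $\sigma$ implements a strategy $g$ if $\sigma\subseteq g$ and for all $smn\in g$ with $s\in\sigma$ there is $smn'\in\sigma$ with $smn\simeq_G smn'$. -}

module Defs where

open import Data.Nat using (ℕ; zero; suc; _+_; _∸_; _≤_; _≤?_; _<_; _≟_)
open import Data.List using (List; []; _∷_; _++_)
open import Data.List.Membership.Propositional using (_∈_)
open import Data.Maybe using (Maybe; just; nothing)
open import Data.Product using (Σ; _×_; _,_)
open import Data.Unit using (⊤)
open import Data.Empty using (⊥)
open import Relation.Nullary using (¬_; yes; no)
open import Relation.Binary.PropositionalEquality using (_≡_; _≢_)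

data OP : Set where
  O P : OP

data QA : Set where
  Q A : QA

record Move (Name : Set) : Set where
  constructor mv
  field
    name : Name
    pl   : OP
    qa   : QA
open Move public

-- Each occurrence carries its pointer:
-- 0 = initial, j > 0 = justified by the occurrence at (1-based) position j.
-- Well-formedness (pointer < own position) is part of 'Legal' below.

module _ {Name : Set} where

  infixl 5 _▸_,_
  data JSeq : Set where
    ε     : JSeq
    _▸_,_ : JSeq → Move Name → ℕ → JSeq

  len : JSeq → ℕ
  len ε = 0
  len (s ▸ _ , _) = suc (len s)

  at : JSeq → ℕ → Maybe (Move Name × ℕ)
  at ε i = nothing
  at (s ▸ m , p) i with i ≟ suc (len s)
  ... | yes _ = just (m , p)
  ... | no  _ = at s i

  prefix : ℕ → JSeq → JSeq
  prefix k ε = ε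
  prefix k (s ▸ m , p) with suc (len s) ≤? k
  ... | yes _ = s ▸ m , p
  ... | no  _ = prefix k s

  Even : JSeq → Set
  Even s = Σ ℕ λ k → len s ≡ k + k

  -- Positions (1-based) of the occurrences retained in the P-view / O-view.
  -- (Fuel argument = length; it always suffices since prefixes are shorter.)
  pviewF : ℕ → JSeq → List ℕ
  pviewF _ ε = []
  pviewF zero (s ▸ m , p) = []
  pviewF (suc f) (s ▸ mv _ P _ , p) = pviewF f s ++ (suc (len s) ∷ [])
  pviewF (suc f) (s ▸ mv _ O _ , zero) = suc (len s) ∷ []
  pviewF (suc f) (s ▸ mv _ O _ , suc j) =
    -- the prefix strictly before position (suc j) has length j
    pviewF f (prefix j s) ++ (suc j ∷ suc (len s) ∷ [])

  oviewF : ℕ → JSeq → List ℕ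
  oviewF _ ε = []
  oviewF zero (s ▸ m , p) = []
  oviewF (suc f) (s ▸ mv _ O _ , p) = oviewF f s ++ (suc (len s) ∷ [])
  oviewF (suc f) (s ▸ mv _ P _ , zero) = suc (len s) ∷ []
  oviewF (suc f) (s ▸ mv _ P _ , suc j) =
    oviewF f (prefix j s) ++ (suc j ∷ suc (len s) ∷ [])

  pviewPos : JSeq → List ℕ
  pviewPos s = pviewF (len s) s

  oviewPos : JSeq → List ℕ
  oviewPos s = oviewF (len s) s

  Alternates : JSeq → Move Name → Set
  Alternates ε m = ⊤
  Alternates (s ▸ m' , _) m = pl m' ≢ pl m

  JustOK : JSeq → Move Name → ℕ → Set
  JustOK t m zero = ⊤
  JustOK t (mv _ P _) (suc j) = suc j ∈ pviewPos t
  JustOK t (mv _ O _) (suc j) = suc j ∈ oviewPos t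

  Legal : JSeq → Set
  Legal ε = ⊤
  Legal (s ▸ m , p) = Legal s × p ≤ len s × Alternates s m × JustOK s m p

record Game (Name : Set) : Set₁ where
  field
    Pos : JSeq {Name} → Set
    _≃_ : JSeq {Name} → JSeq {Name} → Set
    nonempty     : Σ JSeq Pos
    prefixClosed : ∀ s m p → Pos (s ▸ m , p) → Pos s
    legal        : ∀ s → Pos s → Legal s
    ≃-dom   : ∀ {s t} → s ≃ t → Pos s × Pos t
    ≃-refl  : ∀ {s} → Pos s → s ≃ s
    ≃-sym   : ∀ {s t} → s ≃ t → t ≃ s
    ≃-trans : ∀ {s t u} → s ≃ t → t ≃ u → s ≃ u
    I1 : ∀ {s t} → s ≃ t → len s ≡ len t
    I2 : ∀ {s t m n p q} → (s ▸ m , p) ≃ (t ▸ n , q) →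
         s ≃ t × pl m ≡ pl n × qa m ≡ qa n × p ≡ q
    I3 : ∀ {s t m p} → s ≃ t → Pos (s ▸ m , p) →
         Σ (Move Name) λ n → Σ ℕ λ q → Pos (t ▸ n , q) × (s ▸ m , p) ≃ (t ▸ n , q)

  InitialMove : Move Name → Set
  InitialMove m = Σ JSeq λ s → Pos s × Σ ℕ λ i → at s i ≡ just (m , 0)

  Enables : Move Name → Move Name → Set
  Enables m n = Σ JSeq λ s → Pos s × Σ ℕ λ i → Σ ℕ λ j →
    at s i ≡ just (n , suc j) × Σ ℕ λ k → at s (suc j) ≡ just (m , k)

  field
    arena-init   : ∀ m → InitialMove m → pl m ≡ O × qa m ≡ Q
    arena-answer : ∀ m n → Enables m n → qa n ≡ A → qa m ≡ Q
    arena-alt    : ∀ m n → Enables m n → pl m ≢ pl n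
    arena-wf     : ¬ (Σ (ℕ → Move Name) λ f →
                       InitialMove (f 0) × (∀ i → Enables (f i) (f (suc i))))

module _ {Name : Set} (G : Game Name) where
  open Game G

  InPEven : (JSeq {Name} → Set) → Set
  InPEven X = ∀ (s : JSeq {Name}) → X s → Pos s × Even s

  EvenPrefixClosed : (JSeq {Name} → Set) → Set
  EvenPrefixClosed X = ∀ s m p n q → X (s ▸ m , p ▸ n , q) → X s

  Skeleton : (JSeq {Name} → Set) → Set
  Skeleton σ =
    InPEven σ × Σ (JSeq {Name}) σ × EvenPrefixClosed σ ×
    (∀ s m p n q n' q' → σ (s ▸ m , p ▸ n , q) → σ (s ▸ m , p ▸ n' , q') →
       (s ▸ m , p ▸ n , q) ≡ (s ▸ m , p ▸ n' , q'))

  _≲_ : (JSeq {Name} → Set) → (JSeq {Name} → Set) → Set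
  σ ≲ τ = ∀ s m p n q t l pl →
    σ (s ▸ m , p ▸ n , q) → τ t → Pos (t ▸ l , pl) →
    (s ▸ m , p) ≃ (t ▸ l , pl) →
    Σ (Move Name) λ r → Σ ℕ λ pr →
      τ (t ▸ l , pl ▸ r , pr) × (s ▸ m , p ▸ n , q) ≃ (t ▸ l , pl ▸ r , pr)

  Strategy : (JSeq {Name} → Set) → Set
  Strategy g =
    InPEven g × Σ (JSeq {Name}) g × EvenPrefixClosed g ×
    (∀ s m p n q t l pl r pr → g (s ▸ m , p ▸ n , q) → g (t ▸ l , pl ▸ r , pr) →
       (s ▸ m , p) ≃ (t ▸ l , pl) → (s ▸ m , p ▸ n , q) ≃ (t ▸ l , pl ▸ r , pr)) ×
    (∀ (s t : JSeq {Name}) → g s → Pos t → s ≃ t → g t)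

  Implements : (JSeq {Name} → Set) → (JSeq {Name} → Set) → Set
  Implements σ g =
    (∀ s → σ s → g s) ×
    (∀ s m p n q → g (s ▸ m , p ▸ n , q) → σ s →
       Σ (Move Name) λ n' → Σ ℕ λ q' →
         σ (s ▸ m , p ▸ n' , q') × (s ▸ m , p ▸ n , q) ≃ (s ▸ m , p ▸ n' , q'))

-- With excluded middle we can decide, for every odd position sm, whether g
-- answers it at all, and if so fix one answer n.  Restricting g to the plays
-- that only ever use these chosen answers gives a deterministic skeleton.
-- It implements g because g is deterministic up to ≃, and it is valid because
-- g is closed under ≃: an O-move equivalent to one answered in the skeleton
-- is answered in g, hence (up to ≃) in the skeleton.
module Submission where

open import Defs
open import Data.Empty using (⊥; ⊥-elim)
open import Data.Maybe using (Maybe; just; nothing)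
open import Data.Nat using (ℕ; zero; suc; _+_)
open import Data.Nat.Properties using (suc-injective; +-suc; 0≢1+n)
open import Data.Product using (Σ; _×_; _,_; proj₁)
open import Data.Unit using (⊤; tt)
open import Relation.Nullary using (Dec; yes; no)
open import Relation.Binary.PropositionalEquality using (_≡_; _≢_; refl; sym; trans)

module _ {A : Set} {P : A → Set} where

  witness : Dec (Σ A P) → Maybe A
  witness (yes (a , _)) = just a
  witness (no _)        = nothing

  witness-sound : ∀ d {a} → witness d ≡ just a → P a
  witness-sound (yes (_ , pa)) refl = pa

  witness-complete : ∀ d → Σ A P → Σ A λ a → witness d ≡ just a
  witness-complete (yes (a , _)) _ = a , refl
  witness-complete (no ¬p)       p = ⊥-elim (¬p p)

1≢k+k : ∀ k → 1 ≢ k + k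
1≢k+k zero    ()
1≢k+k (suc k) eq = 0≢1+n (trans (suc-injective eq) (+-suc k k))

module _ {Name : Set} (G : Game Name) where
  open Game G

  ≃-Deterministic : (JSeq {Name} → Set) → Set
  ≃-Deterministic g = ∀ s m p n q t l pl r pr →
    g (s ▸ m , p ▸ n , q) → g (t ▸ l , pl ▸ r , pr) →
    (s ▸ m , p) ≃ (t ▸ l , pl) → (s ▸ m , p ▸ n , q) ≃ (t ▸ l , pl ▸ r , pr)

  ≃-Closed : (JSeq {Name} → Set) → Set
  ≃-Closed g = ∀ s t → g s → Pos t → s ≃ t → g t

  ε-∈ : ∀ {X} → InPEven G X → EvenPrefixClosed G X → ∀ s → X s → X ε
  ε-∈ even closed ε xs = xs
  ε-∈ even closed (ε ▸ _ , _) xs with even _ xs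
  ... | _ , k , len≡k+k = ⊥-elim (1≢k+k k len≡k+k)
  ε-∈ even closed (s ▸ m , p ▸ n , q) xs = ε-∈ even closed s (closed s m p n q xs)

  ≃-Closed-respond : ∀ {g} → InPEven G g → ≃-Closed g →
    ∀ {s m p n q t l pl} → g (s ▸ m , p ▸ n , q) → (s ▸ m , p) ≃ (t ▸ l , pl) →
    Σ (Move Name) λ r → Σ ℕ λ pr →
      g (t ▸ l , pl ▸ r , pr) × (s ▸ m , p ▸ n , q) ≃ (t ▸ l , pl ▸ r , pr)
  ≃-Closed-respond g-legal g-closed gsmn sm≃tl
    with I3 sm≃tl (proj₁ (g-legal _ gsmn))
  ... | r , pr , Pos-tlr , smn≃tlr =
    r , pr , g-closed _ _ gsmn Pos-tlr smn≃tlr , smn≃tlr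

module Canonical {Name : Set} (lem : ∀ (X : Set) → Dec X) (g : JSeq {Name} → Set) where

  Responses : JSeq {Name} → Move Name → ℕ → Set
  Responses s m p = Σ (Move Name × ℕ) λ (n , q) → g (s ▸ m , p ▸ n , q)

  response : JSeq {Name} → Move Name → ℕ → Maybe (Move Name × ℕ)
  response s m p = witness (lem (Responses s m p))

  skeleton : JSeq {Name} → Set
  skeleton ε = ⊤
  skeleton (ε ▸ _ , _) = ⊥
  skeleton (s ▸ m , p ▸ n , q) = skeleton s × response s m p ≡ just (n , q)

  skeleton-step⊆ : ∀ {s m p n q} → skeleton (s ▸ m , p ▸ n , q) → g (s ▸ m , p ▸ n , q)
  skeleton-step⊆ {s} {m} {p} (_ , chosen) = witness-sound (lem (Responses s m p)) chosen

  skeleton⊆ : g ε → ∀ s → skeleton s → g s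
  skeleton⊆ gε ε _ = gε
  skeleton⊆ gε (ε ▸ _ , _) ()
  skeleton⊆ gε (s ▸ m , p ▸ n , q) σsmn = skeleton-step⊆ σsmn

  skeleton-deterministic : ∀ {s m p n q n' q'} →
    skeleton (s ▸ m , p ▸ n , q) → skeleton (s ▸ m , p ▸ n' , q') →
    (s ▸ m , p ▸ n , q) ≡ (s ▸ m , p ▸ n' , q')
  skeleton-deterministic (_ , chosen) (_ , chosen') with trans (sym chosen) chosen'
  ... | refl = refl

  skeleton-extend : ∀ {s m p n q} → skeleton s → g (s ▸ m , p ▸ n , q) →
    Σ (Move Name) λ n' → Σ ℕ λ q' →
      skeleton (s ▸ m , p ▸ n' , q') × g (s ▸ m , p ▸ n' , q')
  skeleton-extend {s} {m} {p} {n} {q} σs gsmn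
    with witness-complete (lem (Responses s m p)) ((n , q) , gsmn)
  ... | (n' , q') , chosen = n' , q' , (σs , chosen) , witness-sound (lem (Responses s m p)) chosen

  module _ (G : Game Name) where
    open Game G

    skeleton-isSkeleton : g ε → InPEven G g → Skeleton G skeleton
    skeleton-isSkeleton gε g-legal =
      (λ s σs → g-legal s (skeleton⊆ gε s σs)) ,
      (ε , tt) ,
      (λ _ _ _ _ _ → proj₁) ,
      (λ _ _ _ _ _ _ _ → skeleton-deterministic)

    skeleton-answer : InPEven G g → ≃-Deterministic G g →
      ∀ s m p n q → g (s ▸ m , p ▸ n , q) → skeleton s →
      Σ (Move Name) λ n' → Σ ℕ λ q' →
        skeleton (s ▸ m , p ▸ n' , q') × (s ▸ m , p ▸ n , q) ≃ (s ▸ m , p ▸ n' , q')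
    skeleton-answer g-legal g-det s m p n q gsmn σs with skeleton-extend σs gsmn
    ... | n' , q' , σsmn' , gsmn' =
      n' , q' , σsmn' ,
      g-det s m p n q s m p n' q' gsmn gsmn'
        (≃-refl (prefixClosed _ _ _ (proj₁ (g-legal _ gsmn))))

    skeleton-implements : g ε → InPEven G g → ≃-Deterministic G g →
      Implements G skeleton g
    skeleton-implements gε g-legal g-det = skeleton⊆ gε , skeleton-answer g-legal g-det

    skeleton-valid : InPEven G g → ≃-Deterministic G g → ≃-Closed G g →
      _≲_ G skeleton skeleton
    skeleton-valid g-legal g-det g-closed s m p n q t l pl σsmn σt _ sm≃tl
      with ≃-Closed-respond G g-legal g-closed (skeleton-step⊆ σsmn) sm≃tl
    ... | r , pr , gtlr , smn≃tlr
      with skeleton-answer g-legal g-det t l pl r pr gtlr σt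
    ... | r' , pr' , σtlr' , tlr≃tlr' = r' , pr' , σtlr' , ≃-trans smn≃tlr tlr≃tlr'

mainTheorem1 : {Name : Set} → (∀ (X : Set) → Dec X) →
               (G : Game Name) → (g : JSeq {Name} → Set) → Strategy G g →
               Σ (JSeq {Name} → Set) λ σ →
                 Skeleton G σ × _≲_ G σ σ × Implements G σ g
mainTheorem1 lem G g (g-legal , (s₀ , gs₀) , g-prefixClosed , g-det , g-closed) =
  skeleton ,
  skeleton-isSkeleton G gε g-legal ,
  skeleton-valid G g-legal g-det g-closed ,
  skeleton-implements G gε g-legal g-det
  where
  open Canonical lem g
  gε : g ε
  gε = ε-∈ G g-legal g-prefixClosed s₀ gs₀
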